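{- For ELPs the following hold, where "$A$ is strictly stronger than $B$" means that every pair of ELPs satisfying $A$ satisfies $B$, and there is a pair of ELPs satisfying $B$ but not $A$: (1) strong equivalence is strictly stronger than uniform CWV-equivalence; (2) uniform CWV-equivalence is strictly stronger than uniform WV-equivalence; (3) uniform CWV-equivalence is strictly stronger than (ordinary) CWV-equivalence; (4) uniform WV-equivalence is strictly stronger than (ordinary) WV-equivalence.
   Context: Logic programs, GL-reduct and answer sets $AS(\cdot)$ are as usual for disjunctive programs with nested default negation $\neg$. An ELP is a triple $(\mathcal{A},\mathcal{E},\mathcal{R})$: $\mathcal{A}$ atoms, $\mathcal{E}$ a set of epistemic literals $\mathbf{not}\,\ell$ ($\ell$ a literal), $\mathcal{R}$ a finite set of rules $a_1\vee\cdots\vee a_k\leftarrow\ell_1,\dots,\ell_m,\xi_1,\dots,\xi_j,\neg\xi_{j+1},\dots,\neg\xi_n$ with $\xi_i\in\mathcal{E}$. Union is componentwise; a set of facts $D\subseteq\mathcal{A}$ is the ELP $(\mathcal{A},\emptyset,\{a\leftarrow\mid a\in D\})$. When comparing two ELPs they are assumed to have the same $\mathcal{A}$ and $\mathcal{E}$. For a guess $\Phi\subseteq\mathcal{E}$, the epistemic reduct $\Pi^\Phi$ replaces each $\mathbf{not}\,\ell\in\Phi$ by $\top$ and every remaining $\mathbf{not}$ by $\neg$. $\mathcal{I}$ is $\Phi$-compatible w.r.t. $\mathcal{E}$ iff $\mathcal{I}\neq\emptyset$, each $\mathbf{not}\,\ell\in\Phi$ has some $I\in\mathcal{I}$ with $I\not\models\ell$,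 and each $\mathbf{not}\,\ell\in\mathcal{E}\setminus\Phi$ has $I\models\ell$ for all $I\in\mathcal{I}$. A CWV of $\Pi$ is $\mathcal{M}=AS(\Pi^\Phi)$ that is $\Phi$-compatible for some $\Phi$; a WV is a CWV whose guess is subset-maximal among guesses yielding CWVs. Two ELPs are CWV-equivalent (WV-equivalent) iff they have the same CWVs (WVs); uniformly CWV-(WV-)equivalent iff $\Pi_1\cup D$ and $\Pi_2\cup D$ are CWV-(WV-)equivalent for every set of facts $D\subseteq\mathcal{A}$; strongly equivalent iff for every ELP $\Pi$, $\Pi_1\cup\Pi$ and $\Pi_2\cup\Pi$ are CWV-equivalent (equivalently, WV-equivalent). -}

module Defs where

open import Data.Bool using (Bool; true; false; if_then_else_; not; _∧_; _∨_)
open import Data.List using (List; []; _∷_; _++_; map)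
open import Data.Bool.ListAction using (all; any)
open import Data.List.Membership.Propositional using (_∈_)
open import Data.List.Membership.Propositional.Properties using (∈-++⁺ˡ; ∈-++⁺ʳ)
open import Data.List.Relation.Unary.All as All using (All; []; _∷_)
open import Data.List.Relation.Unary.All.Properties using (++⁺; map⁺)
open import Data.Product using (Σ; ∃; _×_; _,_; proj₁; proj₂)
open import Relation.Nullary using (¬_)
open import Relation.Binary.PropositionalEquality using (_≡_)

_⇔_ : ∀ {ℓ} → Set ℓ → Set ℓ → Set ℓ
P ⇔ Q = (P → Q) × (Q → P)

-- Atoms, interpretations, literals
-- The atom set 𝒜 is a type A.  An interpretation I ⊆ 𝒜 is A → Bool.

Interp : Set → Set
Interp A = A → Bool

data Lit (A : Set) : Set where
  pos : A → Lit A
  neg : A → Lit A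

data Form (A : Set) : Set where
  atom : A → Form A
  ⊤f   : Form A
  ⊥f   : Form A
  ¬f   : Form A → Form A

eval : {A : Set} → Interp A → Form A → Bool
eval I (atom a) = I a
eval I ⊤f       = true
eval I ⊥f       = false
eval I (¬f F)   = not (eval I F)

litF : {A : Set} → Lit A → Form A
litF (pos a) = atom a
litF (neg a) = ¬f (atom a)

_⊨_ : {A : Set} → Interp A → Lit A → Set
I ⊨ ℓ = eval I (litF ℓ) ≡ true

record Rule (A : Set) : Set where
  constructor _⇐_
  field
    head : List A
    body : List (Form A)

Program : Set → Set
Program A = List (Rule A)

SatR : {A : Set} → Interp A → Rule A → Set
SatR I (h ⇐ b) = all (eval I) b ≡ true → any I h ≡ true

Sat : {A : Set} → Interp A → Program A → Set
Sat I P = All (SatR I) P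

-- GL-reduct (Lifschitz–Tang–Turner for nested negation): every maximal
-- negated subformula ¬F is replaced by ⊤ if I ⊨ ¬F and by ⊥ otherwise.
redF : {A : Set} → Interp A → Form A → Form A
redF I (atom a) = atom a
redF I ⊤f       = ⊤f
redF I ⊥f       = ⊥f
redF I (¬f F)   = if eval I (¬f F) then ⊤f else ⊥f

reduct : {A : Set} → Program A → Interp A → Program A
reduct P I = map (λ r → Rule.head r ⇐ map (redF I) (Rule.body r)) P

_⊆I_ : {A : Set} → Interp A → Interp A → Set
J ⊆I I = ∀ a → J a ≡ true → I a ≡ true

AS : {A : Set} → Program A → Interp A → Set
AS P I = Sat I (reduct P I) × (∀ J → J ⊆I I → Sat J (reduct P I) → I ⊆I J)

-- a₁ ∨ ⋯ ∨ a_k ← ℓ₁,…,ℓ_m, not ℓ'₁,…,not ℓ'_j, ¬ not ℓ''₁, …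
-- epistemic literals  not ℓ  are represented by the literal ℓ.
record ERule (A : Set) : Set where
  field
    head : List A
    body : List (Lit A)
    epos : List (Lit A)
    eneg : List (Lit A)   -- ξ_{j+1} … ξ_n  (occurring as ¬ξ)

-- ELP (𝒜, 𝓔, ℛ) with 𝒜 = A and 𝓔 = E (a finite set, given as a list);
-- every epistemic literal occurring in a rule belongs to 𝓔.
WFRule : {A : Set} → List (Lit A) → ERule A → Set
WFRule E r = All (_∈ E) (ERule.epos r) × All (_∈ E) (ERule.eneg r)

record ELP (A : Set) (E : List (Lit A)) : Set where
  field
    rules : List (ERule A)
    wf    : All (WFRule E) rules

open ELP public

wfWeakenˡ : {A : Set} {E E' : List (Lit A)} → (r : ERule A) → WFRule E r → WFRule (E ++ E') r
wfWeakenˡ {E' = E'} r (p , q) = All.map (∈-++⁺ˡ) p , All.map (∈-++⁺ˡ) q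

wfWeakenʳ : {A : Set} {E E' : List (Lit A)} → (r : ERule A) → WFRule E' r → WFRule (E ++ E') r
wfWeakenʳ {E = E} r (p , q) = All.map (∈-++⁺ʳ E) p , All.map (∈-++⁺ʳ E) q

allWeaken : {A : Set} {P Q : ERule A → Set} → (∀ r → P r → Q r) → ∀ {rs} → All P rs → All Q rs
allWeaken f []       = []
allWeaken f (p ∷ ps) = f _ p ∷ allWeaken f ps

_∪_ : {A : Set} {E E' : List (Lit A)} → ELP A E → ELP A E' → ELP A (E ++ E')
Π₁ ∪ Π₂ = record
  { rules = rules Π₁ ++ rules Π₂
  ; wf    = ++⁺ (allWeaken wfWeakenˡ (wf Π₁)) (allWeaken wfWeakenʳ (wf Π₂))
  }

factRule : {A : Set} → A → ERule A
factRule a = record { head = a ∷ [] ; body = [] ; epos = [] ; eneg = [] }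

factsWF : {A : Set} (D : List A) → All (WFRule {A} []) (map factRule D)
factsWF []      = []
factsWF (a ∷ D) = ([] , []) ∷ factsWF D

facts : {A : Set} → List A → ELP A []
facts D = record { rules = map factRule D ; wf = factsWF D }

-- A guess Φ is given by its characteristic function on literals;
-- IsGuess E Φ says Φ ⊆ 𝓔.
Guess : Set → Set
Guess A = Lit A → Bool

IsGuess : {A : Set} → List (Lit A) → Guess A → Set
IsGuess E Φ = ∀ ℓ → Φ ℓ ≡ true → ℓ ∈ E

epi : {A : Set} → Guess A → Lit A → Form A
epi Φ ℓ = if Φ ℓ then ⊤f else ¬f (litF ℓ)

ereduct : {A : Set} → ERule A → Guess A → Rule A
ereduct r Φ = ERule.head r ⇐
  (map litF (ERule.body r) ++ map (epi Φ) (ERule.epos r)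
    ++ map (λ ℓ → ¬f (epi Φ ℓ)) (ERule.eneg r))

_^E_ : {A : Set} {E : List (Lit A)} → ELP A E → Guess A → Program A
Π ^E Φ = map (λ r → ereduct r Φ) (rules Π)

IntSet : Set → Set₁
IntSet A = Interp A → Set

Compatible : {A : Set} → List (Lit A) → Guess A → IntSet A → Set
Compatible E Φ 𝓜 =
  (∃ λ I → 𝓜 I)
  × (∀ ℓ → ℓ ∈ E → Φ ℓ ≡ true → ∃ λ I → 𝓜 I × ¬ (I ⊨ ℓ))
  × (∀ ℓ → ℓ ∈ E → Φ ℓ ≡ false → ∀ I → 𝓜 I → I ⊨ ℓ)

CWVwith : {A : Set} {E : List (Lit A)} → ELP A E → Guess A → IntSet A → Set
CWVwith {E = E} Π Φ 𝓜 =
  IsGuess E Φ × (∀ I → 𝓜 I ⇔ AS (Π ^E Φ) I) × Compatible E Φ 𝓜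

CWV : {A : Set} {E : List (Lit A)} → ELP A E → IntSet A → Set
CWV Π 𝓜 = ∃ λ Φ → CWVwith Π Φ 𝓜

_⊂G_ : {A : Set} → Guess A → Guess A → Set
Φ ⊂G Ψ = (∀ ℓ → Φ ℓ ≡ true → Ψ ℓ ≡ true) × (∃ λ ℓ → Ψ ℓ ≡ true × Φ ℓ ≡ false)

WV : {A : Set} {E : List (Lit A)} → ELP A E → IntSet A → Set₁
WV Π 𝓜 = ∃ λ Φ → CWVwith Π Φ 𝓜 × ¬ (Σ (Guess _) λ Ψ → Σ (IntSet _) λ 𝓝 → Φ ⊂G Ψ × CWVwith Π Ψ 𝓝)

Rel : Set₂
Rel = ∀ {A : Set} {E : List (Lit A)} → ELP A E → ELP A E → Set₁

CWV-equiv : Rel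
CWV-equiv Π₁ Π₂ = ∀ 𝓜 → CWV Π₁ 𝓜 ⇔ CWV Π₂ 𝓜

WV-equiv : Rel
WV-equiv Π₁ Π₂ = ∀ 𝓜 → WV Π₁ 𝓜 ⇔ WV Π₂ 𝓜

uniform-CWV-equiv : Rel
uniform-CWV-equiv Π₁ Π₂ = ∀ D → CWV-equiv (Π₁ ∪ facts D) (Π₂ ∪ facts D)

uniform-WV-equiv : Rel
uniform-WV-equiv Π₁ Π₂ = ∀ D → WV-equiv (Π₁ ∪ facts D) (Π₂ ∪ facts D)

strongly-equiv : Rel
strongly-equiv {A} Π₁ Π₂ = ∀ {E'} (Π : ELP A E') → CWV-equiv (Π₁ ∪ Π) (Π₂ ∪ Π)

StrictlyStronger : Rel → Rel → Set₁
StrictlyStronger R S =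
  (∀ {A : Set} {E : List (Lit A)} (Π₁ Π₂ : ELP A E) → R Π₁ Π₂ → S Π₁ Π₂)
  × (Σ Set λ A → Σ (List (Lit A)) λ E → Σ (ELP A E) λ Π₁ → Σ (ELP A E) λ Π₂ →
       S Π₁ Π₂ × ¬ R Π₁ Π₂)

-- Each implication is bookkeeping: strong equivalence specialises to added facts, D = ∅
-- gives back the programs themselves, and a CWV determines its guess, so CWV-equivalence
-- already decides which guesses are maximal.  The separating pairs use atoms a and b:
--   (1) {←} and {← ¬ not a, ← ¬ not ¬a} have no CWV for any facts D: the constraints force
--       both not a and not ¬a into the guess, and the single answer set D cannot witness
--       both; with a ∨ b ← added instead, the second has the world view {{a}, {b}};
--   (2) a ∨ b ← not ¬a, not ¬b with and without ← ¬a, ¬b: for D ≠ ∅ the constraint is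
--       redundant; for D = ∅ both have the CWV {{a}, {b}} of the full guess, so every WV
--       has that guess, under which the constraint is again redundant, yet the empty
--       guess gives the first program the CWV {∅};
--   (3), (4) {a ← ¬a} and {←} have no CWV, but with the fact a the first has the world
--       view {{a}}.

module Submission where

open import Defs
open import Data.Bool using (Bool; true; false; not; _∧_; _∨_; if_then_else_)
open import Data.Bool.Properties
  using ( ∨-identityʳ; ∨-zeroʳ; ∨-conicalˡ; ∨-conicalʳ; ∧-zeroʳ; ∧-conicalˡ; ∧-conicalʳ
        ; ¬-not; not-injective)
open import Data.Bool.ListAction using (any)
open import Data.Empty using (⊥; ⊥-elim)
open import Data.List using (List; []; _∷_; _++_; map)
open import Data.List.Properties using (++-identityʳ; map-cong)
open import Data.List.Membership.Propositional using (_∈_)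
open import Data.List.Membership.Propositional.Properties using (∈-++⁺ˡ)
open import Data.List.Relation.Unary.All as All using (All; []; _∷_)
open import Data.List.Relation.Unary.Any using (here; there)
open import Data.Product using (_×_; _,_; proj₁; proj₂)
open import Data.Sum using (_⊎_; inj₁; inj₂)
open import Function using (id)
open import Relation.Nullary using (¬_)
open import Relation.Binary.PropositionalEquality
  using (_≡_; _≢_; _≗_; refl; sym; trans; cong; cong₂; subst)

private
  variable
    A : Set
    E E' : List (Lit A)
    Φ Ψ : Guess A
    I J : Interp A
    𝓜 𝓝 : IntSet A

false≢true : false ≢ true
false≢true ()

∧-true : ∀ {x y} → x ≡ true → y ≡ true → x ∧ y ≡ true
∧-true refl refl = refl

not≢true⇒true : ∀ {x} → not x ≢ true → x ≡ true
not≢true⇒true h = not-injective (¬-not h)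

∨-true : ∀ x {y} → x ∨ y ≡ true → x ≡ true ⊎ y ≡ true
∨-true true  _ = inj₁ refl
∨-true false h = inj₂ h

⇔-sym : ∀ {ℓ} {P Q : Set ℓ} → P ⇔ Q → Q ⇔ P
⇔-sym (to , from) = from , to

⇔-trans : ∀ {ℓ} {P Q R : Set ℓ} → P ⇔ Q → Q ⇔ R → P ⇔ R
⇔-trans (to , from) (to' , from') = (λ p → to' (to p)) , (λ r → from (from' r))

redR : Interp A → Rule A → Rule A
redR I r = Rule.head r ⇐ map (redF I) (Rule.body r)

AS-cong : {P Q : Program A} → P ≡ Q → AS P I ⇔ AS Q I
AS-cong refl = id , id

AS-drop-vacuous : (x : Rule A) {P : Program A} →
                  (∀ J → SatR J (redR I x)) → AS (x ∷ P) I ⇔ AS P I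
AS-drop-vacuous x vacuous =
    (λ { ((_ ∷ sat) , least) → sat , λ J J⊆I satJ → least J J⊆I (vacuous J ∷ satJ) })
  , (λ { (sat , least) → (vacuous _ ∷ sat) , λ { J J⊆I (_ ∷ satJ) → least J J⊆I satJ } })

Sat-reduct-facts : (D : List A) → Sat J (reduct (facts D ^E Φ) I) ⇔ All (λ d → J d ≡ true) D
Sat-reduct-facts []      = (λ _ → []) , (λ _ → [])
Sat-reduct-facts (d ∷ D) =
    (λ { (s ∷ sat) → trans (sym (∨-identityʳ _)) (s refl) ∷ proj₁ (Sat-reduct-facts D) sat })
  , (λ { (Jd ∷ Jsat) → (λ _ → trans (∨-identityʳ _) Jd) ∷ proj₂ (Sat-reduct-facts D) Jsat })

facts-AS-least : (D : List A) {I' : Interp A} →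
                 AS (facts D ^E Φ) I → All (λ d → I' d ≡ true) D → I ⊆I I'
facts-AS-least {A = A} {Φ = Φ} {I = I} D {I'} (sat , least) I'⊨D x Ix =
  ∧-conicalʳ (I x) (I' x) (least I∩I' (λ y → ∧-conicalˡ (I y) (I' y)) satI∩I' x Ix)
  where
  I∩I' : Interp A
  I∩I' y = I y ∧ I' y
  satI∩I' : Sat I∩I' (reduct (facts D ^E Φ) I)
  satI∩I' = proj₂ (Sat-reduct-facts D)
    (All.zipWith (λ (Id , I'd) → ∧-true Id I'd)
      (proj₁ (Sat-reduct-facts D) sat , I'⊨D))

empty-constraint-no-AS : {P : Program A} → ¬ AS (([] ⇐ []) ∷ P) I
empty-constraint-no-AS ((s ∷ _) , _) = false≢true (s refl)

-- the constraint  ← ¬ not ℓ ,  which forces  not ℓ  into the guess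
enforce : Lit A → ERule A
enforce ℓ = record { head = [] ; body = [] ; epos = [] ; eneg = ℓ ∷ [] }

enforce-vacuous : (Φ : Guess A) (ℓ : Lit A) → Φ ℓ ≡ true →
                  ∀ J → SatR J (redR I (ereduct (enforce ℓ) Φ))
enforce-vacuous Φ ℓ Φℓ J with Φ ℓ
... | true = λ ()

enforce-violated : (Φ : Guess A) (ℓ : Lit A) → Φ ℓ ≡ false → I ⊨ ℓ →
                   ¬ SatR I (redR I (ereduct (enforce ℓ) Φ))
enforce-violated Φ ℓ Φℓ I⊨ℓ sat rewrite Φℓ | I⊨ℓ = false≢true (sat refl)

epi-cong : Φ ≗ Ψ → epi Φ ≗ epi Ψ
epi-cong Φ≗Ψ ℓ = cong (λ b → if b then ⊤f else ¬f (litF ℓ)) (Φ≗Ψ ℓ)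

ereduct-cong : Φ ≗ Ψ → (r : ERule A) → ereduct r Φ ≡ ereduct r Ψ
ereduct-cong Φ≗Ψ r =
  cong₂ (λ B₁ B₂ → ERule.head r ⇐ (map litF (ERule.body r) ++ B₁ ++ B₂))
    (map-cong (epi-cong Φ≗Ψ) (ERule.epos r))
    (map-cong (λ ℓ → cong ¬f (epi-cong Φ≗Ψ ℓ)) (ERule.eneg r))

^E-cong : (Π : ELP A E) → Φ ≗ Ψ → Π ^E Φ ≡ Π ^E Ψ
^E-cong Π Φ≗Ψ = map-cong (ereduct-cong Φ≗Ψ) (rules Π)

CWVwith-transport : (Π : ELP A E) (Π' : ELP A E') →
                    (∀ {ℓ} → ℓ ∈ E → ℓ ∈ E') → (∀ {ℓ} → ℓ ∈ E' → ℓ ∈ E) → Φ ≗ Ψ →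
                    (∀ I → AS (Π ^E Φ) I ⇔ AS (Π' ^E Ψ) I) →
                    CWVwith Π Φ 𝓜 → CWVwith Π' Ψ 𝓜
CWVwith-transport Π Π' E⊆E' E'⊆E Φ≗Ψ AS⇔ (guess , 𝓜⇔AS , inhabited , unknown , known) =
    (λ ℓ Ψℓ → E⊆E' (guess ℓ (trans (Φ≗Ψ ℓ) Ψℓ)))
  , (λ I → (λ I∈𝓜 → proj₁ (AS⇔ I) (proj₁ (𝓜⇔AS I) I∈𝓜))
         , (λ as → proj₂ (𝓜⇔AS I) (proj₂ (AS⇔ I) as)))
  , inhabited
  , (λ ℓ ℓ∈E' Ψℓ → unknown ℓ (E'⊆E ℓ∈E') (trans (Φ≗Ψ ℓ) Ψℓ))
  , (λ ℓ ℓ∈E' Ψℓ → known ℓ (E'⊆E ℓ∈E') (trans (Φ≗Ψ ℓ) Ψℓ))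

CWVwith-resp-AS : (Π Π' : ELP A E) → (∀ I → AS (Π ^E Φ) I ⇔ AS (Π' ^E Φ) I) →
                  CWVwith Π Φ 𝓜 → CWVwith Π' Φ 𝓜
CWVwith-resp-AS Π Π' = CWVwith-transport Π Π' id id (λ _ → refl)

CWVwith-resp-guess : (Π : ELP A E) → Φ ≗ Ψ → CWVwith Π Φ 𝓜 → CWVwith Π Ψ 𝓜
CWVwith-resp-guess Π Φ≗Ψ = CWVwith-transport Π Π id id Φ≗Ψ (λ _ → AS-cong (^E-cong Π Φ≗Ψ))

-- A guessed literal lies in 𝓔, where compatibility reads the guess off 𝓜.
CWVwith-guess-mono : (Π Π' : ELP A E) {ℓ : Lit A} →
                     CWVwith Π Φ 𝓜 → CWVwith Π' Ψ 𝓜 → Φ ℓ ≡ true → Ψ ℓ ≡ true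
CWVwith-guess-mono {Ψ = Ψ} Π Π' {ℓ} (guess , _ , _ , unknown , _) (_ , _ , _ , _ , known') Φℓ
  with Ψ ℓ in Ψℓ
... | true  = refl
... | false =
  let I , I∈𝓜 , I⊭ℓ = unknown ℓ (guess ℓ Φℓ) Φℓ in ⊥-elim (I⊭ℓ (known' ℓ (guess ℓ Φℓ) Ψℓ I I∈𝓜))

CWVwith-guess-unique : (Π Π' : ELP A E) → CWVwith Π Φ 𝓜 → CWVwith Π' Ψ 𝓜 → Φ ≗ Ψ
CWVwith-guess-unique {Φ = Φ} {Ψ = Ψ} Π Π' c c' ℓ with Φ ℓ in Φℓ | Ψ ℓ in Ψℓ
... | true  | true  = refl
... | false | false = refl
... | true  | false = ⊥-elim (false≢true (trans (sym Ψℓ) (CWVwith-guess-mono Π Π' c c' Φℓ)))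
... | false | true  = ⊥-elim (false≢true (trans (sym Φℓ) (CWVwith-guess-mono Π' Π c' c Ψℓ)))

CWV-resp : (Π : ELP A E) (Π' : ELP A E') →
           (∀ {Φ 𝓜} → CWVwith Π Φ 𝓜 → CWVwith Π' Φ 𝓜) → CWV Π 𝓜 → CWV Π' 𝓜
CWV-resp Π Π' to (Φ , c) = Φ , to c

WV-resp : (Π : ELP A E) (Π' : ELP A E') →
          (∀ {Φ 𝓜} → CWVwith Π Φ 𝓜 → CWVwith Π' Φ 𝓜) →
          (∀ {Φ 𝓜} → CWVwith Π' Φ 𝓜 → CWVwith Π Φ 𝓜) →
          WV Π 𝓜 → WV Π' 𝓜
WV-resp Π Π' to from (Φ , c , maximal) =
  Φ , to c , λ (Ψ , 𝓝 , Φ⊂Ψ , c') → maximal (Ψ , 𝓝 , Φ⊂Ψ , from c')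

WV⇒CWV : (Π : ELP A E) → WV Π 𝓜 → CWV Π 𝓜
WV⇒CWV Π (Φ , c , _) = Φ , c

CWV⇒CWVwith : (Π₁ Π₂ : ELP A E) → (∀ {𝓜} → CWV Π₁ 𝓜 → CWV Π₂ 𝓜) →
              CWVwith Π₁ Φ 𝓜 → CWVwith Π₂ Φ 𝓜
CWV⇒CWVwith Π₁ Π₂ to c with to (_ , c)
... | Ψ , c' = CWVwith-resp-guess Π₂ (λ ℓ → sym (CWVwith-guess-unique Π₁ Π₂ c c' ℓ)) c'

CWV-equiv⇒WV-equiv : (Π₁ Π₂ : ELP A E) → CWV-equiv Π₁ Π₂ → WV-equiv Π₁ Π₂
CWV-equiv⇒WV-equiv Π₁ Π₂ eq 𝓜 = WV-resp Π₁ Π₂ to from , WV-resp Π₂ Π₁ from to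
  where
  to : ∀ {Φ 𝓜} → CWVwith Π₁ Φ 𝓜 → CWVwith Π₂ Φ 𝓜
  to = CWV⇒CWVwith Π₁ Π₂ (proj₁ (eq _))
  from : ∀ {Φ 𝓜} → CWVwith Π₂ Φ 𝓜 → CWVwith Π₁ Φ 𝓜
  from = CWV⇒CWVwith Π₂ Π₁ (proj₂ (eq _))

CWVwith-AS : (Π : ELP A E) → CWVwith Π Φ 𝓜 → 𝓜 I → AS (Π ^E Φ) I
CWVwith-AS Π (_ , 𝓜⇔AS , _) I∈𝓜 = proj₁ (𝓜⇔AS _) I∈𝓜

NoCWV : ELP A E → Set₁
NoCWV Π = ∀ 𝓜 → ¬ CWV Π 𝓜

no-AS⇒NoCWV : (Π : ELP A E) → (∀ Φ I → ¬ AS (Π ^E Φ) I) → NoCWV Π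
no-AS⇒NoCWV Π no-AS 𝓜 (Φ , c@(_ , _ , (I , I∈𝓜) , _)) = no-AS Φ I (CWVwith-AS Π c I∈𝓜)

NoCWV⇒CWV-equiv : (Π₁ Π₂ : ELP A E) → NoCWV Π₁ → NoCWV Π₂ → CWV-equiv Π₁ Π₂
NoCWV⇒CWV-equiv Π₁ Π₂ none₁ none₂ 𝓜 = (λ c → ⊥-elim (none₁ 𝓜 c)) , (λ c → ⊥-elim (none₂ 𝓜 c))

⊥-rule : ERule A
⊥-rule = record { head = [] ; body = [] ; epos = [] ; eneg = [] }

⊥-program : ELP A E
⊥-program = record { rules = ⊥-rule ∷ [] ; wf = ([] , []) ∷ [] }

⊥-program-NoCWV : NoCWV (⊥-program {E = E})
⊥-program-NoCWV {E = E} = no-AS⇒NoCWV (⊥-program {E = E}) (λ _ _ → empty-constraint-no-AS)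

⊥-program-∪-NoCWV : (Π : ELP A E') → NoCWV (⊥-program {E = E} ∪ Π)
⊥-program-∪-NoCWV {E = E} Π = no-AS⇒NoCWV (⊥-program {E = E} ∪ Π) (λ _ _ → empty-constraint-no-AS)

Full : List (Lit A) → Guess A → Set
Full E Φ = ∀ ℓ → ℓ ∈ E → Φ ℓ ≡ true

full-CWV⇒WV : (Π : ELP A E) → Full E Φ → CWVwith Π Φ 𝓜 → WV Π 𝓜
full-CWV⇒WV Π full c =
  _ , c , λ (Ψ , 𝓝 , (_ , ℓ , Ψℓ , Φℓ) , (guessΨ , _)) →
    false≢true (trans (sym Φℓ) (full ℓ (guessΨ ℓ Ψℓ)))

WV⇒full-CWV : (Π : ELP A E) → Full E Φ → CWVwith Π Φ 𝓝 → WV Π 𝓜 → CWVwith Π Φ 𝓜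
WV⇒full-CWV {E = E} {Φ = Φ} {𝓝 = 𝓝} Π full cΦ (Ψ , c , maximal) = CWVwith-resp-guess Π Ψ≗Φ c
  where
  guessΨ : IsGuess E Ψ
  guessΨ = proj₁ c
  Ψ≗Φ : Ψ ≗ Φ
  Ψ≗Φ ℓ with Ψ ℓ in Ψℓ | Φ ℓ in Φℓ
  ... | true  | true  = refl
  ... | false | false = refl
  ... | true  | false = ⊥-elim (false≢true (trans (sym Φℓ) (full ℓ (guessΨ ℓ Ψℓ))))
  ... | false | true  =
    ⊥-elim (maximal (Φ , 𝓝 , ((λ ℓ' Ψℓ' → full ℓ' (guessΨ ℓ' Ψℓ')) , ℓ , Φℓ , Ψℓ) , cΦ))

^E-∪-facts-[] : (Π : ELP A E) → (Π ∪ facts []) ^E Φ ≡ Π ^E Φ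
^E-∪-facts-[] {Φ = Φ} Π = cong (map (λ r → ereduct r Φ)) (++-identityʳ (rules Π))

CWVwith-∪-facts-[] : (Π : ELP A E) → CWVwith Π Φ 𝓜 ⇔ CWVwith (Π ∪ facts []) Φ 𝓜
CWVwith-∪-facts-[] {E = E} Π =
    CWVwith-transport Π (Π ∪ facts []) ∈-++⁺ˡ ++[]⇒ (λ _ → refl)
      (λ _ → AS-cong (sym (^E-∪-facts-[] Π)))
  , CWVwith-transport (Π ∪ facts []) Π ++[]⇒ ∈-++⁺ˡ (λ _ → refl)
      (λ _ → AS-cong (^E-∪-facts-[] Π))
  where
  ++[]⇒ : ∀ {ℓ} → ℓ ∈ E ++ [] → ℓ ∈ E
  ++[]⇒ {ℓ} = subst (ℓ ∈_) (++-identityʳ E)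

CWV-∪-facts-[] : (Π : ELP A E) → CWV Π 𝓜 ⇔ CWV (Π ∪ facts []) 𝓜
CWV-∪-facts-[] Π =
    CWV-resp Π (Π ∪ facts []) (proj₁ (CWVwith-∪-facts-[] Π))
  , CWV-resp (Π ∪ facts []) Π (proj₂ (CWVwith-∪-facts-[] Π))

WV-∪-facts-[] : (Π : ELP A E) → WV Π 𝓜 ⇔ WV (Π ∪ facts []) 𝓜
WV-∪-facts-[] Π =
    WV-resp Π (Π ∪ facts []) (proj₁ (CWVwith-∪-facts-[] Π)) (proj₂ (CWVwith-∪-facts-[] Π))
  , WV-resp (Π ∪ facts []) Π (proj₂ (CWVwith-∪-facts-[] Π)) (proj₁ (CWVwith-∪-facts-[] Π))

strong⇒uniform-CWV : (Π₁ Π₂ : ELP A E) → strongly-equiv Π₁ Π₂ → uniform-CWV-equiv Π₁ Π₂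
strong⇒uniform-CWV Π₁ Π₂ strong D = strong (facts D)

uniform-CWV⇒uniform-WV : (Π₁ Π₂ : ELP A E) → uniform-CWV-equiv Π₁ Π₂ → uniform-WV-equiv Π₁ Π₂
uniform-CWV⇒uniform-WV Π₁ Π₂ uniform D =
  CWV-equiv⇒WV-equiv (Π₁ ∪ facts D) (Π₂ ∪ facts D) (uniform D)

uniform-CWV⇒CWV : (Π₁ Π₂ : ELP A E) → uniform-CWV-equiv Π₁ Π₂ → CWV-equiv Π₁ Π₂
uniform-CWV⇒CWV Π₁ Π₂ uniform 𝓜 =
  ⇔-trans (CWV-∪-facts-[] Π₁) (⇔-trans (uniform [] 𝓜) (⇔-sym (CWV-∪-facts-[] Π₂)))

uniform-WV⇒WV : (Π₁ Π₂ : ELP A E) → uniform-WV-equiv Π₁ Π₂ → WV-equiv Π₁ Π₂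
uniform-WV⇒WV Π₁ Π₂ uniform 𝓜 =
  ⇔-trans (WV-∪-facts-[] Π₁) (⇔-trans (uniform [] 𝓜) (⇔-sym (WV-∪-facts-[] Π₂)))

pattern a = true
pattern b = false

∅ : Interp Bool
∅ _ = false

only : Bool → Interp Bool
only a x = x
only b x = not x

∅-guess : Guess Bool
∅-guess _ = false

infix 25 _⊨a∨b
_⊨a∨b : Interp Bool → Set
J ⊨a∨b = any J (a ∷ b ∷ []) ≡ true

true⇒⊨a∨b : ∀ J x → J x ≡ true → J ⊨a∨b
true⇒⊨a∨b J a Ja rewrite Ja = refl
true⇒⊨a∨b J b Jb rewrite Jb = ∨-zeroʳ (J a)

only-⊨a∨b : ∀ x → only x ⊨a∨b
only-⊨a∨b a = refl
only-⊨a∨b b = refl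

only-least : ∀ x → J ⊆I only x → J ⊨a∨b → only x ⊆I J
only-least {J = J} a J⊆a J⊨a∨b a _ with ∨-true (J a) J⊨a∨b
... | inj₁ Ja  = Ja
... | inj₂ Jb∨ = ⊥-elim (false≢true (J⊆a b (trans (sym (∨-identityʳ _)) Jb∨)))
only-least {J = J} b J⊆b J⊨a∨b b _ with ∨-true (J a) J⊨a∨b
... | inj₁ Ja  = ⊥-elim (false≢true (J⊆b a Ja))
... | inj₂ Jb∨ = trans (sym (∨-identityʳ _)) Jb∨

only-AS : ∀ x {P : Program Bool} → (∀ J → Sat J (reduct P (only x)) ⇔ J ⊨a∨b) → AS P (only x)
only-AS x sat⇔ =
  proj₂ (sat⇔ (only x)) (only-⊨a∨b x) , λ J J⊆x satJ → only-least x J⊆x (proj₁ (sat⇔ J) satJ)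

E-a : List (Lit Bool)
E-a = pos a ∷ neg a ∷ []

a-unknown : ELP Bool E-a
a-unknown = record
  { rules = enforce (pos a) ∷ enforce (neg a) ∷ []
  ; wf    = ([] , here refl ∷ []) ∷ ([] , there (here refl) ∷ []) ∷ []
  }

a-unknown-∪-AS : (X : ELP Bool E') → Φ (pos a) ≡ true → Φ (neg a) ≡ true →
                 AS ((a-unknown ∪ X) ^E Φ) I ⇔ AS (X ^E Φ) I
a-unknown-∪-AS {Φ = Φ} X Φa Φ¬a =
  ⇔-trans (AS-drop-vacuous (ereduct (enforce (pos a)) Φ) {P = ereduct (enforce (neg a)) Φ ∷ X ^E Φ}
             (enforce-vacuous Φ (pos a) Φa))
          (AS-drop-vacuous (ereduct (enforce (neg a)) Φ) {P = X ^E Φ}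
             (enforce-vacuous Φ (neg a) Φ¬a))

a-unknown-guess : (X : ELP Bool E') {ℓ : Lit Bool} → ℓ ∈ E-a →
                  CWVwith (a-unknown ∪ X) Φ 𝓜 → Φ ℓ ≡ true
a-unknown-guess {Φ = Φ} X (here refl) c@(_ , _ , (I , I∈𝓜) , _ , known) = ¬-not λ Φa →
  enforce-violated Φ (pos a) Φa (known (pos a) (here refl) Φa I I∈𝓜)
    (All.head (proj₁ (CWVwith-AS (a-unknown ∪ X) c I∈𝓜)))
a-unknown-guess {Φ = Φ} X (there (here refl)) c@(_ , _ , (I , I∈𝓜) , _ , known) = ¬-not λ Φ¬a →
  enforce-violated Φ (neg a) Φ¬a (known (neg a) (there (here refl)) Φ¬a I I∈𝓜)
    (All.head (All.tail (proj₁ (CWVwith-AS (a-unknown ∪ X) c I∈𝓜))))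

-- With facts only, all answer sets coincide, so none can refute a while another refutes ¬a.
a-unknown-∪-facts-NoCWV : (D : List Bool) → NoCWV (a-unknown ∪ facts D)
a-unknown-∪-facts-NoCWV D 𝓜 (Φ , c@(_ , _ , _ , unknown , _)) =
  let Φa                 = a-unknown-guess (facts D) (here refl) c
      Φ¬a                = a-unknown-guess (facts D) (there (here refl)) c
      I₁ , I₁∈𝓜 , I₁⊭a  = unknown (pos a) (here refl) Φa
      I₂ , I₂∈𝓜 , I₂⊭¬a = unknown (neg a) (there (here refl)) Φ¬a
      I₂⊆I₁ = facts-AS-least D
        (proj₁ (a-unknown-∪-AS (facts D) Φa Φ¬a) (CWVwith-AS (a-unknown ∪ facts D) c I₂∈𝓜))
        (proj₁ (Sat-reduct-facts D)
          (All.tail (All.tail (proj₁ (CWVwith-AS (a-unknown ∪ facts D) c I₁∈𝓜)))))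
  in I₁⊭a (I₂⊆I₁ a (not≢true⇒true I₂⊭¬a))

a-or-b : ELP Bool []
a-or-b = record
  { rules = record { head = a ∷ b ∷ [] ; body = [] ; epos = [] ; eneg = [] } ∷ []
  ; wf    = ([] , []) ∷ []
  }

Φ-a : Guess Bool
Φ-a (pos a) = true
Φ-a (neg a) = true
Φ-a _       = false

𝓜-a : IntSet Bool
𝓜-a = AS ((a-unknown ∪ a-or-b) ^E Φ-a)

only-∈-𝓜-a : ∀ x → 𝓜-a (only x)
only-∈-𝓜-a x = proj₂ (a-unknown-∪-AS {Φ = Φ-a} {I = only x} a-or-b refl refl)
  (only-AS x λ J → (λ { (s ∷ []) → s refl }) , (λ J⊨a∨b → (λ _ → J⊨a∨b) ∷ []))

a-unknown-∪-a-or-b-CWV : CWVwith (a-unknown ∪ a-or-b) Φ-a 𝓜-a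
a-unknown-∪-a-or-b-CWV =
    (λ { (pos a) _ → here refl ; (neg a) _ → there (here refl) })
  , (λ _ → id , id)
  , (only a , only-∈-𝓜-a a)
  , (λ { _ (here refl) _ → only b , only-∈-𝓜-a b , λ ()
       ; _ (there (here refl)) _ → only a , only-∈-𝓜-a a , λ () })
  , (λ { _ (here refl) () ; _ (there (here refl)) () })

a-unknown-not-strong : ¬ strongly-equiv ⊥-program a-unknown
a-unknown-not-strong strong =
  ⊥-program-∪-NoCWV a-or-b 𝓜-a (proj₂ (strong a-or-b 𝓜-a) (Φ-a , a-unknown-∪-a-or-b-CWV))

a-unknown-uniform-CWV : uniform-CWV-equiv ⊥-program a-unknown
a-unknown-uniform-CWV D =
  NoCWV⇒CWV-equiv (⊥-program ∪ facts D) (a-unknown ∪ facts D)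
    (⊥-program-∪-NoCWV (facts D)) (a-unknown-∪-facts-NoCWV D)

a-if-¬a-rule : ERule Bool
a-if-¬a-rule = record { head = a ∷ [] ; body = neg a ∷ [] ; epos = [] ; eneg = [] }

a-if-¬a : ELP Bool []
a-if-¬a = record { rules = a-if-¬a-rule ∷ [] ; wf = ([] , []) ∷ [] }

a-if-¬a-violated : ∀ I → I a ≡ false → ¬ SatR I (redR I ((a ∷ []) ⇐ (¬f (atom a) ∷ [])))
a-if-¬a-violated I Ia rewrite Ia = λ sat → false≢true (sat refl)

a-if-¬a-vacuous : ∀ I → I a ≡ true → ∀ J → SatR J (redR I ((a ∷ []) ⇐ (¬f (atom a) ∷ [])))
a-if-¬a-vacuous I Ia J rewrite Ia = λ ()

a-if-¬a-no-AS : ∀ Φ I → ¬ AS (a-if-¬a ^E Φ) I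
a-if-¬a-no-AS Φ I (sat , least) = a-if-¬a-violated I Ia≡false (All.head sat)
  where
  Ia≡false : I a ≡ false
  Ia≡false = ¬-not λ Ia → false≢true (least ∅ (λ _ ()) (a-if-¬a-vacuous I Ia ∅ ∷ []) a Ia)

𝓜-fact-a : IntSet Bool
𝓜-fact-a = AS ((a-if-¬a ∪ facts (a ∷ [])) ^E ∅-guess)

only-a-∈-𝓜-fact-a : 𝓜-fact-a (only a)
only-a-∈-𝓜-fact-a =
  ((λ ()) ∷ (λ _ → refl) ∷ []) , λ { J J⊆a (_ ∷ s ∷ []) →
    only-least a J⊆a (true⇒⊨a∨b J a (trans (sym (∨-identityʳ _)) (s refl))) }

a-if-¬a-∪-fact-a-CWV : CWVwith (a-if-¬a ∪ facts (a ∷ [])) ∅-guess 𝓜-fact-a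
a-if-¬a-∪-fact-a-CWV =
  (λ _ ()) , (λ _ → id , id) , (only a , only-a-∈-𝓜-fact-a) , (λ _ ()) , (λ _ ())

a-if-¬a-CWV-equiv : CWV-equiv a-if-¬a ⊥-program
a-if-¬a-CWV-equiv =
  NoCWV⇒CWV-equiv a-if-¬a ⊥-program (no-AS⇒NoCWV a-if-¬a a-if-¬a-no-AS) ⊥-program-NoCWV

a-if-¬a-not-uniform-CWV : ¬ uniform-CWV-equiv a-if-¬a ⊥-program
a-if-¬a-not-uniform-CWV uniform =
  ⊥-program-∪-NoCWV (facts (a ∷ [])) 𝓜-fact-a
    (proj₁ (uniform (a ∷ []) 𝓜-fact-a) (∅-guess , a-if-¬a-∪-fact-a-CWV))

a-if-¬a-not-uniform-WV : ¬ uniform-WV-equiv a-if-¬a ⊥-program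
a-if-¬a-not-uniform-WV uniform =
  ⊥-program-∪-NoCWV (facts (a ∷ [])) 𝓜-fact-a (WV⇒CWV (⊥-program ∪ facts (a ∷ []))
    (proj₁ (uniform (a ∷ []) 𝓜-fact-a)
      (full-CWV⇒WV (a-if-¬a ∪ facts (a ∷ [])) (λ _ ()) a-if-¬a-∪-fact-a-CWV)))

E-ab : List (Lit Bool)
E-ab = neg a ∷ neg b ∷ []

choice-rule : ERule Bool
choice-rule = record { head = a ∷ b ∷ [] ; body = [] ; epos = neg a ∷ neg b ∷ [] ; eneg = [] }

forbid-∅ : ERule Bool
forbid-∅ = record { head = [] ; body = neg a ∷ neg b ∷ [] ; epos = [] ; eneg = [] }

choice-rule-wf : WFRule E-ab choice-rule
choice-rule-wf = (here refl ∷ there (here refl) ∷ []) , []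

choice : ELP Bool E-ab
choice = record { rules = choice-rule ∷ [] ; wf = choice-rule-wf ∷ [] }

constrained-choice : ELP Bool E-ab
constrained-choice = record
  { rules = forbid-∅ ∷ choice-rule ∷ []
  ; wf    = ([] , []) ∷ choice-rule-wf ∷ []
  }

forbid-∅-reduct : Rule Bool
forbid-∅-reduct = [] ⇐ (¬f (atom a) ∷ ¬f (atom b) ∷ [])

forbid-∅-violated : ∀ I → I a ≡ false → I b ≡ false → ¬ SatR I (redR I forbid-∅-reduct)
forbid-∅-violated I Ia Ib rewrite Ia | Ib = λ sat → false≢true (sat refl)

forbid-∅-vacuous : ∀ I → I ⊨a∨b → ∀ J → SatR J (redR I forbid-∅-reduct)
forbid-∅-vacuous I I⊨a∨b J with ∨-true (I a) I⊨a∨b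
... | inj₁ Ia  rewrite Ia = λ ()
... | inj₂ Ib∨ rewrite trans (sym (∨-identityʳ (I b))) Ib∨ =
  λ sat → trans (sym (∧-zeroʳ _)) sat

forbid-∅-Sat⇒⊨a∨b : ∀ I → SatR I (redR I forbid-∅-reduct) → I ⊨a∨b
forbid-∅-Sat⇒⊨a∨b I sat = ¬-not λ ¬I⊨a∨b →
  forbid-∅-violated I (∨-conicalˡ (I a) _ ¬I⊨a∨b)
    (∨-conicalˡ (I b) false (∨-conicalʳ (I a) _ ¬I⊨a∨b)) sat

choice-CWVwith⇔ : (X : ELP Bool E') → (∀ I → AS ((choice ∪ X) ^E Φ) I → I ⊨a∨b) →
                  CWVwith (choice ∪ X) Φ 𝓜 ⇔ CWVwith (constrained-choice ∪ X) Φ 𝓜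
choice-CWVwith⇔ {Φ = Φ} X nonempty =
    CWVwith-resp-AS (choice ∪ X) (constrained-choice ∪ X) AS⇔
  , CWVwith-resp-AS (constrained-choice ∪ X) (choice ∪ X) (λ I → ⇔-sym (AS⇔ I))
  where
  AS⇔ : ∀ I → AS ((choice ∪ X) ^E Φ) I ⇔ AS ((constrained-choice ∪ X) ^E Φ) I
  AS⇔ I =
      (λ as → proj₂ (drop-forbid-∅ (forbid-∅-vacuous I (nonempty I as))) as)
    , (λ as → proj₁ (drop-forbid-∅ (forbid-∅-vacuous I
                      (forbid-∅-Sat⇒⊨a∨b I (All.head (proj₁ as))))) as)
    where
    drop-forbid-∅ : (∀ J → SatR J (redR I forbid-∅-reduct)) →
                    AS ((constrained-choice ∪ X) ^E Φ) I ⇔ AS ((choice ∪ X) ^E Φ) I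
    drop-forbid-∅ = AS-drop-vacuous forbid-∅-reduct {P = (choice ∪ X) ^E Φ}

choice-∪-facts-⊨a∨b : ∀ d D → AS ((choice ∪ facts (d ∷ D)) ^E Φ) I → I ⊨a∨b
choice-∪-facts-⊨a∨b {I = I} d D (sat , _) =
  true⇒⊨a∨b I d (trans (sym (∨-identityʳ _)) (All.head (All.tail sat) refl))

Φ-ab : Guess Bool
Φ-ab (pos _) = false
Φ-ab (neg _) = true

Φ-ab-Full : Full E-ab Φ-ab
Φ-ab-Full _ (here refl)         = refl
Φ-ab-Full _ (there (here refl)) = refl

𝓜-ab : IntSet Bool
𝓜-ab = AS ((choice ∪ facts []) ^E Φ-ab)

only-∈-𝓜-ab : ∀ x → 𝓜-ab (only x)
only-∈-𝓜-ab x = only-AS x {P = (choice ∪ facts []) ^E Φ-ab}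
  λ J → (λ { (s ∷ []) → s refl }) , (λ J⊨a∨b → (λ _ → J⊨a∨b) ∷ [])

choice-Φ-ab-CWV : CWVwith (choice ∪ facts []) Φ-ab 𝓜-ab
choice-Φ-ab-CWV =
    (λ { (neg a) _ → here refl ; (neg b) _ → there (here refl) })
  , (λ _ → id , id)
  , (only a , only-∈-𝓜-ab a)
  , (λ { _ (here refl) _ → only a , only-∈-𝓜-ab a , λ ()
       ; _ (there (here refl)) _ → only b , only-∈-𝓜-ab b , λ () })
  , (λ { _ (here refl) () ; _ (there (here refl)) () })

choice-∪-[]-WV-equiv : WV-equiv (choice ∪ facts []) (constrained-choice ∪ facts [])
choice-∪-[]-WV-equiv 𝓜 =
    (λ w → full-CWV⇒WV constrained₀ Φ-ab-Full
             (proj₁ same (WV⇒full-CWV choice₀ Φ-ab-Full choice-Φ-ab-CWV w)))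
  , (λ w → full-CWV⇒WV choice₀ Φ-ab-Full
             (proj₂ same (WV⇒full-CWV constrained₀ Φ-ab-Full (proj₁ same choice-Φ-ab-CWV) w)))
  where
  choice₀ constrained₀ : ELP Bool (E-ab ++ [])
  choice₀      = choice ∪ facts []
  constrained₀ = constrained-choice ∪ facts []
  same : ∀ {𝓜} → CWVwith (choice ∪ facts []) Φ-ab 𝓜 ⇔ CWVwith (constrained-choice ∪ facts []) Φ-ab 𝓜
  same = choice-CWVwith⇔ (facts []) (λ _ (sat , _) → All.head sat refl)

choice-uniform-WV : uniform-WV-equiv choice constrained-choice
choice-uniform-WV []      = choice-∪-[]-WV-equiv
choice-uniform-WV (d ∷ D) =
  CWV-equiv⇒WV-equiv (choice ∪ facts (d ∷ D)) (constrained-choice ∪ facts (d ∷ D))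
    λ 𝓜 → CWV-resp (choice ∪ facts (d ∷ D)) (constrained-choice ∪ facts (d ∷ D)) (proj₁ same)
        , CWV-resp (constrained-choice ∪ facts (d ∷ D)) (choice ∪ facts (d ∷ D)) (proj₂ same)
  where
  same : ∀ {Φ 𝓜} →
         CWVwith (choice ∪ facts (d ∷ D)) Φ 𝓜 ⇔ CWVwith (constrained-choice ∪ facts (d ∷ D)) Φ 𝓜
  same = choice-CWVwith⇔ (facts (d ∷ D)) (λ _ → choice-∪-facts-⊨a∨b d D)

choice-∅-guess-Sat : ∀ I J → (I a ≡ true → I b ≡ true → J ⊨a∨b) →
                     Sat J (reduct ((choice ∪ facts []) ^E ∅-guess) I)
choice-∅-guess-Sat I J both⇒ with I a | I b
... | true  | true  = (λ _ → both⇒ refl refl) ∷ []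
... | true  | false = (λ ()) ∷ []
... | false | _     = (λ ()) ∷ []

choice-∅-guess-AS⇒∅ : AS ((choice ∪ facts []) ^E ∅-guess) I → ∀ x → I x ≡ false
choice-∅-guess-AS⇒∅ {I = I} (_ , least) x = ¬-not λ Ix →
  false≢true (least ∅ (λ _ ()) (choice-∅-guess-Sat I ∅ λ Ia Ib → ⊥-elim (not-both Ia Ib)) x Ix)
  where
  not-both : I a ≡ true → I b ≡ true → ⊥
  not-both Ia Ib = false≢true
    (least (only a) (λ { a _ → Ia }) (choice-∅-guess-Sat I (only a) λ _ _ → refl) b Ib)

𝓜-∅ : IntSet Bool
𝓜-∅ = AS ((choice ∪ facts []) ^E ∅-guess)

∅-∈-𝓜-∅ : 𝓜-∅ ∅
∅-∈-𝓜-∅ = choice-∅-guess-Sat ∅ ∅ (λ ()) , λ _ _ _ _ ()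

choice-∅-guess-CWV : CWVwith (choice ∪ facts []) ∅-guess 𝓜-∅
choice-∅-guess-CWV =
    (λ _ ())
  , (λ _ → id , id)
  , (∅ , ∅-∈-𝓜-∅)
  , (λ _ _ ())
  , (λ { _ (here refl) _ _ I∈𝓜 → cong not (choice-∅-guess-AS⇒∅ I∈𝓜 a)
       ; _ (there (here refl)) _ _ I∈𝓜 → cong not (choice-∅-guess-AS⇒∅ I∈𝓜 b) })

constrained-choice-∅-not-AS : (X : ELP Bool E') → ¬ AS ((constrained-choice ∪ X) ^E Φ) ∅
constrained-choice-∅-not-AS X (sat , _) = false≢true (forbid-∅-Sat⇒⊨a∨b ∅ (All.head sat))

choice-not-uniform-CWV : ¬ uniform-CWV-equiv choice constrained-choice
choice-not-uniform-CWV uniform =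
  let Φ , c = proj₁ (uniform [] 𝓜-∅) (∅-guess , choice-∅-guess-CWV)
  in constrained-choice-∅-not-AS {Φ = Φ} (facts [])
       (CWVwith-AS (constrained-choice ∪ facts []) c ∅-∈-𝓜-∅)

theorem3 : StrictlyStronger strongly-equiv uniform-CWV-equiv
           × StrictlyStronger uniform-CWV-equiv uniform-WV-equiv
           × StrictlyStronger uniform-CWV-equiv CWV-equiv
           × StrictlyStronger uniform-WV-equiv WV-equiv
theorem3 =
    (strong⇒uniform-CWV ,
     (Bool , E-a , ⊥-program , a-unknown , a-unknown-uniform-CWV , a-unknown-not-strong))
  , (uniform-CWV⇒uniform-WV ,
     (Bool , E-ab , choice , constrained-choice , choice-uniform-WV , choice-not-uniform-CWV))
  , (uniform-CWV⇒CWV ,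
     (Bool , [] , a-if-¬a , ⊥-program , a-if-¬a-CWV-equiv , a-if-¬a-not-uniform-CWV))
  , (uniform-WV⇒WV ,
     (Bool , [] , a-if-¬a , ⊥-program ,
      CWV-equiv⇒WV-equiv a-if-¬a ⊥-program a-if-¬a-CWV-equiv , a-if-¬a-not-uniform-WV))
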